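{- Let $\delta\in(0,1]$ and $\Delta$ be fixed, and let $\Sigma$ be a bipartite graph with bipartition $X\cup Y$ and integer parameter $d$ such that $d(v)\in[\delta d,d]$ for all $v\in X\cup Y$, $d(v)\ge d(w)$ whenever $v\in X,w\in Y,v\sim w$, and $|N(v)\cap N(w)|\le\Delta$ for all $v\ne w$. Let $A\subseteq X$ be 2-linked with $|[A]|=a$, $|N(A)|=g$ and $|\nabla(N(A),X\setminus[A])|=\kappa$, let $G=N(A)$, and let $(S,F)$ be a $\psi$-approximation for $A$, where $\psi\ll d$. Then (a) $|S\setminus[A]|=O(\kappa/d)$ and $|G\setminus F|=O(\kappa/d)$; (b) $|\nabla(S,V(\Sigma)\setminus F)|=O(\kappa\psi/d)$; (c) $|S|\le|F|+O(\kappa\psi/d^2)$.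
   Context: $d(v)$ is the degree of $v$, $N(\cdot)$ neighbourhood, and for $Z\subseteq V(\Sigma)$, $d_Z(v)=|N(v)\cap Z|$. The closure of $A$ is $[A]=\{v:N(v)\subseteq N(A)\}$. $\nabla(P,Q)$ is the set of edges with one end in $P$ and the other in $Q$. $A$ is 2-linked if it is connected in the square of $\Sigma$ (vertices adjacent iff at distance at most 2). A $\psi$-approximation for $A$ is a pair $(S,F)$ with $S\subseteq X$, $F\subseteq Y$ such that $F\subseteq N(A)$ and $S\supseteq[A]$; $d_F(u)\ge d(u)-\psi$ for all $u\in S$; and $d_{X\setminus S}(v)\ge d(v)-\psi$ for all $v\in Y\setminus F$. Asymptotic notation refers to $d\to\infty$, with implicit constants depending only on $\delta$ and $\Delta$; $\psi\ll d$ means $\psi/d\to0$. -}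

module Defs where

open import Data.Nat using (ℕ; zero; suc; _+_; _*_; _≤_)
open import Data.Bool using (Bool; true; false; _∧_; _∨_; not; if_then_else_; T)
open import Data.Fin using (Fin; zero; suc)
open import Data.Product using (_×_)
open import Relation.Nullary using (¬_)
open import Relation.Binary.PropositionalEquality using (_≡_)

countF : ∀ {n} → (Fin n → Bool) → ℕ
countF {zero} _ = 0
countF {suc n} f = (if f zero then 1 else 0) + countF (λ i → f (suc i))

anyF : ∀ {n} → (Fin n → Bool) → Bool
anyF {zero} _ = false
anyF {suc n} f = f zero ∨ anyF (λ i → f (suc i))

sumF : ∀ {n} → (Fin n → ℕ) → ℕ
sumF {zero} _ = 0
sumF {suc n} f = f zero + sumF (λ i → f (suc i))

allF : ∀ {n} → (Fin n → Bool) → Bool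
allF {zero} _ = true
allF {suc n} f = f zero ∧ allF (λ i → f (suc i))

record BipGraph (m n : ℕ) : Set where
  field
    adj : Fin m → Fin n → Bool

module _ {m n : ℕ} (Σ : BipGraph m n) where
  open BipGraph Σ

  degX : Fin m → ℕ
  degX x = countF (λ y → adj x y)

  degY : Fin n → ℕ
  degY y = countF (λ x → adj x y)

  degInY : (Fin n → Bool) → Fin m → ℕ
  degInY Z x = countF (λ y → adj x y ∧ Z y)

  degInX : (Fin m → Bool) → Fin n → ℕ
  degInX Z y = countF (λ x → adj x y ∧ Z x)

  codegX : Fin m → Fin m → ℕ
  codegX x x' = countF (λ y → adj x y ∧ adj x' y)

  codegY : Fin n → Fin n → ℕ
  codegY y y' = countF (λ x → adj x y ∧ adj x y')

  nbhd : (Fin m → Bool) → Fin n → Bool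
  nbhd A y = anyF (λ x → A x ∧ adj x y)

  closure : (Fin m → Bool) → Fin m → Bool
  closure A x = allF (λ y → not (adj x y) ∨ nbhd A y)

  edgesYX : (Fin n → Bool) → (Fin m → Bool) → ℕ
  edgesYX P Q = sumF (λ x → countF (λ y → adj x y ∧ P y ∧ Q x))

  edgesXY : (Fin m → Bool) → (Fin n → Bool) → ℕ
  edgesXY P Q = sumF (λ x → countF (λ y → adj x y ∧ P x ∧ Q y))

  near : Fin m → Fin m → Set
  near x x' = T (anyF (λ y → adj x y ∧ adj x' y))

  data Walk2 (A : Fin m → Bool) : Fin m → Fin m → Set where
    here : ∀ {x} → T (A x) → Walk2 A x x
    step : ∀ {x y z} → Walk2 A x y → T (A z) → near y z → Walk2 A x z

  TwoLinked : (Fin m → Bool) → Set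
  TwoLinked A = ∀ x x' → T (A x) → T (A x') → Walk2 A x x'

  record IsApprox (ψ : ℕ) (A S : Fin m → Bool) (F : Fin n → Bool) : Set where
    field
      F⊆NA   : ∀ y → T (F y) → T (nbhd A y)
      clA⊆S  : ∀ x → T (closure A x) → T (S x)
      degS   : ∀ x → T (S x) → degX x ≤ degInY F x + ψ
      degYF  : ∀ y → T (not (F y)) → degY y ≤ degInX (λ x → not (S x)) y + ψ

{-# OPTIONS --safe #-}
module Submission where

-- For x ∈ S ∖ [A] the approximation gives d(x) ≤ d_F(x) + ψ, and since F ⊆ N(A) every edge
-- counted by d_F(x) lies in ∇(N(A), X ∖ [A]); as ψ ≪ δd ≤ d(x), such an x carries ≳ d of the
-- κ boundary edges. Dually, [A] ⊆ S makes every y ∈ G ∖ F carry ≳ d boundary edges. This is (a).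
-- An edge from S to Y ∖ F starts in S ∖ [A] or ends in G ∖ F, and both kinds of vertices have at
-- most ψ such edges, which gives (b). For (c) write |S| = Σ_{x∈S} Σ_{y∼x} 1/d(x) and charge each
-- edge into F to its end y ∈ F, which costs 1/d(y) ≥ 1/d(x): then |S| ≤ |F| + |∇(S, Y ∖ F)|/(δd),
-- and (b) bounds the last term.

open import Data.Bool using (Bool; true; false; T; not; _∧_; _∨_; if_then_else_)
open import Data.Empty using (⊥-elim)
open import Data.Fin using (Fin; zero; suc)
open import Data.Nat using (ℕ; zero; suc; _+_; _*_; _≤_; _<_; _!; z≤n; s≤s; NonZero; >-nonZero)
open import Data.Nat.Divisibility using (_∣_; ∣-trans; m∣m*n; m≤n⇒m!∣n!)
open import Data.Nat.Properties
open import Algebra.Properties.Semiring.Sum +-*-semiring using (sum; ∑-comm; ∑-distrib-+; *-distribˡ-sum)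
open import Data.Nat.Tactic.RingSolver using (solve-∀)
open import Data.Product using (∃; _×_; _,_)
open import Data.Sum using (_⊎_; inj₁; inj₂)
open import Data.Unit using (tt)
open import Function using (_∘_)
open import Relation.Binary.PropositionalEquality
open import Relation.Nullary using (¬_)

open import Defs

χ : Bool → ℕ
χ b = if b then 1 else 0

χ-mono : ∀ {a b} → (T a → T b) → χ a ≤ χ b
χ-mono {false} _ = z≤n
χ-mono {true} {true} _ = ≤-refl
χ-mono {true} {false} a⇒b = ⊥-elim (a⇒b tt)

χ-≤-+ : ∀ {a b c} → (T a → T b ⊎ T c) → χ a ≤ χ b + χ c
χ-≤-+ {false} _ = z≤n
χ-≤-+ {true} {true} _ = s≤s z≤n
χ-≤-+ {true} {false} {true} _ = s≤s z≤n
χ-≤-+ {true} {false} {false} a⇒b∨c with a⇒b∨c tt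
... | inj₁ ()
... | inj₂ ()

T-∧-proj₁ : ∀ a {b} → T (a ∧ b) → T a
T-∧-proj₁ true _ = tt

T-∧-proj₂ : ∀ a {b} → T (a ∧ b) → T b
T-∧-proj₂ true b = b

T-allF : ∀ {n} (f : Fin n → Bool) → T (allF f) → ∀ i → T (f i)
T-allF f all zero with f zero
... | true = tt
T-allF f all (suc i) with f zero
... | true = T-allF (f ∘ suc) all i

sumF≡sum : ∀ {n} (f : Fin n → ℕ) → sumF f ≡ sum f
sumF≡sum {zero} f = refl
sumF≡sum {suc n} f = cong (f zero +_) (sumF≡sum (f ∘ suc))

sumF-cong : ∀ {n} {f g : Fin n → ℕ} → (∀ i → f i ≡ g i) → sumF f ≡ sumF g
sumF-cong {zero} _ = refl
sumF-cong {suc n} f≗g = cong₂ _+_ (f≗g zero) (sumF-cong (f≗g ∘ suc))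

sumF-mono : ∀ {n} {f g : Fin n → ℕ} → (∀ i → f i ≤ g i) → sumF f ≤ sumF g
sumF-mono {zero} _ = z≤n
sumF-mono {suc n} f≤g = +-mono-≤ (f≤g zero) (sumF-mono (f≤g ∘ suc))

sumF-zero : ∀ n → sumF {n} (λ _ → 0) ≡ 0
sumF-zero zero = refl
sumF-zero (suc n) = sumF-zero n

sumF-+ : ∀ {n} (f g : Fin n → ℕ) → sumF (λ i → f i + g i) ≡ sumF f + sumF g
sumF-+ f g = begin
  sumF (λ i → f i + g i)  ≡⟨ sumF≡sum (λ i → f i + g i) ⟩
  sum (λ i → f i + g i)   ≡⟨ ∑-distrib-+ f g ⟩
  sum f + sum g           ≡⟨ cong₂ _+_ (sumF≡sum f) (sumF≡sum g) ⟨
  sumF f + sumF g         ∎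
  where open ≡-Reasoning

sumF-*ˡ : ∀ {n} k (f : Fin n → ℕ) → k * sumF f ≡ sumF (λ i → k * f i)
sumF-*ˡ k f = begin
  k * sumF f            ≡⟨ cong (k *_) (sumF≡sum f) ⟩
  k * sum f             ≡⟨ *-distribˡ-sum k f ⟩
  sum (λ i → k * f i)   ≡⟨ sumF≡sum (λ i → k * f i) ⟨
  sumF (λ i → k * f i)  ∎
  where open ≡-Reasoning

sumF-comm : ∀ {m n} (h : Fin m → Fin n → ℕ) →
            sumF (λ i → sumF (h i)) ≡ sumF (λ j → sumF (λ i → h i j))
sumF-comm h = begin
  sumF (λ i → sumF (h i))          ≡⟨ sumF-cong (sumF≡sum ∘ h) ⟩
  sumF (λ i → sum (h i))           ≡⟨ sumF≡sum (λ i → sum (h i)) ⟩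
  sum (λ i → sum (h i))            ≡⟨ ∑-comm h ⟩
  sum (λ j → sum (λ i → h i j))    ≡⟨ sumF≡sum (λ j → sum (λ i → h i j)) ⟨
  sumF (λ j → sum (λ i → h i j))   ≡⟨ sumF-cong (λ j → sumF≡sum (λ i → h i j)) ⟨
  sumF (λ j → sumF (λ i → h i j))  ∎
  where open ≡-Reasoning

*-sumF-weighted-≤ : ∀ {n} k {W} (c w : Fin n → ℕ) → (∀ i → k * w i ≤ W) →
                    k * sumF (λ i → c i * w i) ≤ W * sumF c
*-sumF-weighted-≤ k {W} c w k*w≤W = begin
  k * sumF (λ i → c i * w i)    ≡⟨ sumF-*ˡ k (λ i → c i * w i) ⟩
  sumF (λ i → k * (c i * w i))  ≡⟨ sumF-cong (λ i → swap-left k (c i) (w i)) ⟩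
  sumF (λ i → c i * (k * w i))  ≤⟨ sumF-mono (λ i → *-monoʳ-≤ (c i) (k*w≤W i)) ⟩
  sumF (λ i → c i * W)          ≡⟨ sumF-cong (λ i → *-comm (c i) W) ⟩
  sumF (λ i → W * c i)          ≡⟨ sumF-*ˡ W c ⟨
  W * sumF c                    ∎
  where
  open ≤-Reasoning
  swap-left : ∀ a b c → a * (b * c) ≡ b * (a * c)
  swap-left = solve-∀

countF≡sumF : ∀ {n} (f : Fin n → Bool) → countF f ≡ sumF (χ ∘ f)
countF≡sumF {zero} f = refl
countF≡sumF {suc n} f = cong (χ (f zero) +_) (countF≡sumF (f ∘ suc))

countF-false : ∀ n → countF {n} (λ _ → false) ≡ 0
countF-false zero = refl
countF-false (suc n) = countF-false n

countF≤n : ∀ {n} (f : Fin n → Bool) → countF f ≤ n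
countF≤n {zero} f = z≤n
countF≤n {suc n} f = +-mono-≤ (χ-mono {f zero} {true} _) (countF≤n (f ∘ suc))

countF-mono : ∀ {n} {f g : Fin n → Bool} → (∀ i → T (f i) → T (g i)) → countF f ≤ countF g
countF-mono {zero} _ = z≤n
countF-mono {suc n} f⇒g = +-mono-≤ (χ-mono (f⇒g zero)) (countF-mono (f⇒g ∘ suc))

countF-≤-+ : ∀ {n} {f g h : Fin n → Bool} → (∀ i → T (f i) → T (g i) ⊎ T (h i)) →
             countF f ≤ countF g + countF h
countF-≤-+ {f = f} {g} {h} f⇒g∨h = begin
  countF f                        ≡⟨ countF≡sumF f ⟩
  sumF (χ ∘ f)                    ≤⟨ sumF-mono (λ i → χ-≤-+ (f⇒g∨h i)) ⟩
  sumF (λ i → χ (g i) + χ (h i))  ≡⟨ sumF-+ (χ ∘ g) (χ ∘ h) ⟩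
  sumF (χ ∘ g) + sumF (χ ∘ h)     ≡⟨ cong₂ _+_ (countF≡sumF g) (countF≡sumF h) ⟨
  countF g + countF h             ∎
  where open ≤-Reasoning

countF-split : ∀ {n} (f g : Fin n → Bool) →
               countF f ≡ countF (λ i → f i ∧ g i) + countF (λ i → f i ∧ not (g i))
countF-split {zero} f g = refl
countF-split {suc n} f g with f zero | g zero
... | false | _ = countF-split (f ∘ suc) (g ∘ suc)
... | true | true = cong suc (countF-split (f ∘ suc) (g ∘ suc))
... | true | false = trans (cong suc (countF-split (f ∘ suc) (g ∘ suc))) (sym (+-suc _ _))

countF-comm : ∀ {m n} (b : Fin m → Fin n → Bool) →
              sumF (λ i → countF (b i)) ≡ sumF (λ j → countF (λ i → b i j))
countF-comm b = begin
  sumF (λ i → countF (b i))            ≡⟨ sumF-cong (countF≡sumF ∘ b) ⟩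
  sumF (λ i → sumF (χ ∘ b i))          ≡⟨ sumF-comm (λ i j → χ (b i j)) ⟩
  sumF (λ j → sumF (λ i → χ (b i j)))  ≡⟨ sumF-cong (λ j → countF≡sumF (λ i → b i j)) ⟨
  sumF (λ j → countF (λ i → b i j))    ∎
  where open ≡-Reasoning

sumF-χ-* : ∀ {n} (f : Fin n → Bool) k → sumF (λ i → χ (f i) * k) ≡ countF f * k
sumF-χ-* {zero} f k = refl
sumF-χ-* {suc n} f k =
  trans (cong (χ (f zero) * k +_) (sumF-χ-* (f ∘ suc) k)) (sym (*-distribʳ-+ k (χ (f zero)) _))

countF-*-≤-sumF : ∀ {n} {f : Fin n → Bool} {k} (g : Fin n → ℕ) →
                  (∀ i → T (f i) → k ≤ g i) → countF f * k ≤ sumF g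
countF-*-≤-sumF {zero} g _ = z≤n
countF-*-≤-sumF {suc n} {f} g bound with f zero | bound zero
... | true | k≤g₀ = +-mono-≤ (k≤g₀ tt) (countF-*-≤-sumF (g ∘ suc) (bound ∘ suc))
... | false | _ = ≤-trans (countF-*-≤-sumF (g ∘ suc) (bound ∘ suc)) (m≤n+m _ (g zero))

sumF-countF-∧-≤ : ∀ {m n} {f : Fin m → Bool} {k} (h : Fin m → Fin n → Bool) →
                  (∀ i → T (f i) → countF (h i) ≤ k) →
                  sumF (λ i → countF (λ j → f i ∧ h i j)) ≤ countF f * k
sumF-countF-∧-≤ {zero} h _ = z≤n
sumF-countF-∧-≤ {suc m} {n} {f} {k} h bound with f zero | bound zero
... | true | h₀≤k = +-mono-≤ (h₀≤k tt) (sumF-countF-∧-≤ (h ∘ suc) (bound ∘ suc))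
... | false | _ = begin
  countF {n} (λ _ → false) + rest  ≡⟨ cong (_+ rest) (countF-false n) ⟩
  rest                             ≤⟨ sumF-countF-∧-≤ (h ∘ suc) (bound ∘ suc) ⟩
  countF (f ∘ suc) * k             ∎
  where
  open ≤-Reasoning
  rest : ℕ
  rest = sumF (λ i → countF (λ j → f (suc i) ∧ h (suc i) j))

countF-*-as-double-sum : ∀ {m n} (b : Fin m → Fin n → Bool) (w : Fin m → ℕ) {L} →
                         (∀ i → w i * countF (b i) ≡ L) →
                         ∀ f → countF f * L ≡ sumF (λ i → sumF (λ j → χ (f i ∧ b i j) * w i))
countF-*-as-double-sum {n = n} b w {L} w*count≡L f = trans (sym (sumF-χ-* f L)) (sumF-cong row)
  where
  row : ∀ i → χ (f i) * L ≡ sumF (λ j → χ (f i ∧ b i j) * w i)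
  row i with f i
  ... | false = sym (sumF-zero n)
  ... | true = begin
    L + 0                         ≡⟨ +-identityʳ L ⟩
    L                             ≡⟨ w*count≡L i ⟨
    w i * countF (b i)            ≡⟨ *-comm (w i) _ ⟩
    countF (b i) * w i            ≡⟨ sumF-χ-* (b i) (w i) ⟨
    sumF (λ j → χ (b i j) * w i)  ∎
    where open ≡-Reasoning

m≤n⇒m∣n! : ∀ {m n} .{{_ : NonZero m}} → m ≤ n → m ∣ n !
m≤n⇒m∣n! {suc k} m≤n = ∣-trans (m∣m*n (k !)) (m≤n⇒m!∣n! m≤n)

positive-degree : ∀ {p r d D} → 1 ≤ p → 1 ≤ d → p * d ≤ r * D → 0 < D
positive-degree {D = suc _} _ _ _ = s≤s z≤n
positive-degree {r = r} {D = zero} 1≤p 1≤d p*d≤r*0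
  with ≤-trans (*-mono-≤ 1≤p 1≤d) (≤-trans p*d≤r*0 (≤-reflexive (*-zeroʳ r)))
... | ()

degree-deficit : ∀ {p d D ψ} r K → 1 ≤ p → p * d ≤ r * D → D ≤ K + ψ → 2 * r * ψ ≤ d →
                 d ≤ 2 * r * K
degree-deficit {p} {d} {D} {ψ} r K 1≤p p*d≤r*D D≤K+ψ 2rψ≤d =
  ≤-trans d≤p*d (+-cancelʳ-≤ (p * d) (p * d) (2 * r * K) (begin
    p * d + p * d          ≡⟨ double (p * d) ⟩
    2 * (p * d)            ≤⟨ *-monoʳ-≤ 2 (≤-trans p*d≤r*D (*-monoʳ-≤ r D≤K+ψ)) ⟩
    2 * (r * (K + ψ))      ≡⟨ expand r K ψ ⟩
    2 * r * K + 2 * r * ψ  ≤⟨ +-monoʳ-≤ (2 * r * K) (≤-trans 2rψ≤d d≤p*d) ⟩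
    2 * r * K + p * d      ∎))
  where
  open ≤-Reasoning
  d≤p*d : d ≤ p * d
  d≤p*d = m≤n*m d p {{>-nonZero 1≤p}}
  double : ∀ a → a + a ≡ 2 * a
  double = solve-∀
  expand : ∀ r K ψ → 2 * (r * (K + ψ)) ≡ 2 * r * K + 2 * r * ψ
  expand = solve-∀

-- Fractional double counting

χ-edge-split : ∀ s a f {u v} → (T a → u ≤ v) →
               χ (s ∧ a) * u ≤ χ (f ∧ a) * v + χ (a ∧ s ∧ not f) * u
χ-edge-split false a f _ = z≤n
χ-edge-split true false f _ = z≤n
χ-edge-split true true true u≤v = ≤-trans (*-monoʳ-≤ 1 (u≤v tt)) (m≤m+n _ _)
χ-edge-split true true false _ = ≤-refl

module _ {m n : ℕ} (G : BipGraph m n) where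
  open BipGraph G

  -- |S| = Σ_{x∈S} Σ_{y∼x} 1/d(x) scaled by L, with the weights w = L/d on X and w′ = L/d on Y.
  weighted-double-count :
    ∀ {L} (w : Fin m → ℕ) (w′ : Fin n → ℕ) →
    (∀ x → w x * degX G x ≡ L) → (∀ y → w′ y * degY G y ≡ L) →
    (∀ x y → T (adj x y) → w x ≤ w′ y) →
    ∀ S F → countF S * L ≤ countF F * L + sumF (λ x → countF (λ y → adj x y ∧ S x ∧ not (F y)) * w x)
  weighted-double-count {L} w w′ w*degX≡L w′*degY≡L w≤w′ S F = begin
    countF S * L
      ≡⟨ countF-*-as-double-sum adj w w*degX≡L S ⟩
    sumF (λ x → sumF (λ y → χ (S x ∧ adj x y) * w x))
      ≤⟨ sumF-mono (λ x → sumF-mono (λ y → χ-edge-split (S x) (adj x y) (F y) (w≤w′ x y))) ⟩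
    sumF (λ x → sumF (λ y → into-F x y + into-Y∖F x y))
      ≡⟨ sumF-cong (λ x → sumF-+ (into-F x) (into-Y∖F x)) ⟩
    sumF (λ x → sumF (into-F x) + sumF (into-Y∖F x))
      ≡⟨ sumF-+ (λ x → sumF (into-F x)) (λ x → sumF (into-Y∖F x)) ⟩
    sumF (λ x → sumF (into-F x)) + sumF (λ x → sumF (into-Y∖F x))
      ≡⟨ cong₂ _+_ into-F-total
           (sumF-cong (λ x → sumF-χ-* (λ y → adj x y ∧ S x ∧ not (F y)) (w x))) ⟩
    countF F * L + sumF (λ x → countF (λ y → adj x y ∧ S x ∧ not (F y)) * w x)
      ∎
    where
    open ≤-Reasoning
    into-F into-Y∖F : Fin m → Fin n → ℕ
    into-F x y = χ (F y ∧ adj x y) * w′ y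
    into-Y∖F x y = χ (adj x y ∧ S x ∧ not (F y)) * w x
    into-F-total : sumF (λ x → sumF (into-F x)) ≡ countF F * L
    into-F-total =
      trans (sumF-comm into-F) (sym (countF-*-as-double-sum (λ y x → adj x y) w′ w′*degY≡L F))

  module _ (degX>0 : ∀ x → 0 < degX G x) (degY>0 : ∀ y → 0 < degY G y)
           (degY≤degX : ∀ x y → T (adj x y) → degY G y ≤ degX G x) where

    -- (m + n)! is a common multiple of all degrees, so the weights 1/d(v) become integers.
    *-countF-≤-*-countF+∇ : ∀ k r → (∀ x → k ≤ r * degX G x) → ∀ S F →
                            k * countF S ≤ k * countF F + r * edgesXY G S (not ∘ F)
    *-countF-≤-*-countF+∇ k r k≤r*degX S F =
      *-cancelʳ-≤ (k * countF S) (k * countF F + r * e) L {{(m + n) !≢0}} (begin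
        k * countF S * L
          ≡⟨ *-assoc k (countF S) L ⟩
        k * (countF S * L)
          ≤⟨ *-monoʳ-≤ k (weighted-double-count w w′ w*degX≡L w′*degY≡L w≤w′ S F) ⟩
        k * (countF F * L + sumF (λ x → c x * w x))
          ≡⟨ *-distribˡ-+ k (countF F * L) _ ⟩
        k * (countF F * L) + k * sumF (λ x → c x * w x)
          ≤⟨ +-monoʳ-≤ (k * (countF F * L)) (*-sumF-weighted-≤ k c w k*w≤r*L) ⟩
        k * (countF F * L) + r * L * e
          ≡⟨ regroup k (countF F) L r e ⟩
        (k * countF F + r * e) * L
          ∎)
      where
      open ≤-Reasoning
      L e : ℕ
      L = (m + n) !
      e = edgesXY G S (not ∘ F)
      c : Fin m → ℕ
      c x = countF (λ y → adj x y ∧ S x ∧ not (F y))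
      degX∣L : ∀ x → degX G x ∣ L
      degX∣L x = m≤n⇒m∣n! {{>-nonZero (degX>0 x)}} (≤-trans (countF≤n (adj x)) (m≤n+m n m))
      degY∣L : ∀ y → degY G y ∣ L
      degY∣L y = m≤n⇒m∣n! {{>-nonZero (degY>0 y)}} (≤-trans (countF≤n (λ x → adj x y)) (m≤m+n m n))
      w : Fin m → ℕ
      w x = _∣_.quotient (degX∣L x)
      w′ : Fin n → ℕ
      w′ y = _∣_.quotient (degY∣L y)
      w*degX≡L : ∀ x → w x * degX G x ≡ L
      w*degX≡L x = sym (_∣_.equality (degX∣L x))
      w′*degY≡L : ∀ y → w′ y * degY G y ≡ L
      w′*degY≡L y = sym (_∣_.equality (degY∣L y))
      w≤w′ : ∀ x y → T (adj x y) → w x ≤ w′ y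
      w≤w′ x y x~y = *-cancelʳ-≤ (w x) (w′ y) (degX G x) {{>-nonZero (degX>0 x)}} (begin
        w x * degX G x   ≡⟨ trans (w*degX≡L x) (sym (w′*degY≡L y)) ⟩
        w′ y * degY G y  ≤⟨ *-monoʳ-≤ (w′ y) (degY≤degX x y x~y) ⟩
        w′ y * degX G x  ∎)
      k*w≤r*L : ∀ x → k * w x ≤ r * L
      k*w≤r*L x = begin
        k * w x               ≤⟨ *-monoˡ-≤ (w x) (k≤r*degX x) ⟩
        r * degX G x * w x    ≡⟨ *-assoc r (degX G x) (w x) ⟩
        r * (degX G x * w x)  ≡⟨ cong (r *_) (trans (*-comm (degX G x) (w x)) (w*degX≡L x)) ⟩
        r * L                 ∎
      regroup : ∀ k f L r e → k * (f * L) + r * L * e ≡ (k * f + r * e) * L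
      regroup = solve-∀

module _ {m n : ℕ} (G : BipGraph m n) {ψ : ℕ} {A S : Fin m → Bool} {F : Fin n → Bool}
         (approx : IsApprox G ψ A S F) where
  open BipGraph G
  open IsApprox approx

  private
    N : Fin n → Bool
    N = nbhd G A
    cl : Fin m → Bool
    cl = closure G A

  boundary-edge : Fin m → Fin n → Bool
  boundary-edge x y = adj x y ∧ N y ∧ not (cl x)

  closure∧adj⇒nbhd : ∀ {x y} → T (cl x) → T (adj x y) → T (N y)
  closure∧adj⇒nbhd {x} {y} x∈[A] x~y
    with adj x y | N y | T-allF (λ y → not (adj x y) ∨ N y) x∈[A] y
  ... | true | true | _ = tt

  degX≤boundary+ψ : ∀ {x} → T (S x) → T (not (cl x)) → degX G x ≤ countF (boundary-edge x) + ψ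
  degX≤boundary+ψ {x} x∈S x∉[A] =
    ≤-trans (degS x x∈S) (+-monoˡ-≤ ψ (countF-mono F-edge⇒boundary))
    where
    F-edge⇒boundary : ∀ y → T (adj x y ∧ F y) → T (boundary-edge x y)
    F-edge⇒boundary y x~y∈F with adj x y | F y | N y | F⊆NA y
    ... | true | true | true | _ = x∉[A]
    ... | true | true | false | F⇒N = ⊥-elim (F⇒N tt)

  degY≤boundary+ψ : ∀ {y} → T (N y) → T (not (F y)) →
                    degY G y ≤ countF (λ x → boundary-edge x y) + ψ
  degY≤boundary+ψ {y} y∈G y∉F =
    ≤-trans (degYF y y∉F) (+-monoˡ-≤ ψ (countF-mono X∖S-edge⇒boundary))
    where
    X∖S-edge⇒boundary : ∀ x → T (adj x y ∧ not (S x)) → T (boundary-edge x y)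
    X∖S-edge⇒boundary x x~y∉S with adj x y | S x | N y | cl x | clA⊆S x
    ... | true | false | true | false | _ = tt
    ... | true | false | false | _ | _ = y∈G
    ... | true | false | true | true | [A]⇒S = [A]⇒S tt

  degInY-Y∖F≤ψ : ∀ {x} → T (S x) → countF (λ y → adj x y ∧ not (F y)) ≤ ψ
  degInY-Y∖F≤ψ {x} x∈S = +-cancelˡ-≤ (degInY G F x) _ _ (begin
    degInY G F x + countF (λ y → adj x y ∧ not (F y))  ≡⟨ countF-split (adj x) F ⟨
    degX G x                                            ≤⟨ degS x x∈S ⟩
    degInY G F x + ψ                                    ∎)
    where open ≤-Reasoning

  degInX-S≤ψ : ∀ {y} → T (not (F y)) → countF (λ x → adj x y ∧ S x) ≤ ψ
  degInX-S≤ψ {y} y∉F = +-cancelʳ-≤ (degInX G (not ∘ S) y) _ _ (begin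
    countF (λ x → adj x y ∧ S x) + degInX G (not ∘ S) y  ≡⟨ countF-split (λ x → adj x y) S ⟨
    degY G y                                              ≤⟨ degYF y y∉F ⟩
    degInX G (not ∘ S) y + ψ                              ≡⟨ +-comm _ ψ ⟩
    ψ + degInX G (not ∘ S) y                              ∎)
    where open ≤-Reasoning

  ∇[S,Y∖F]≤|S∖[A]|ψ+|G∖F|ψ :
    edgesXY G S (not ∘ F) ≤ countF (λ x → S x ∧ not (cl x)) * ψ + countF (λ y → N y ∧ not (F y)) * ψ
  ∇[S,Y∖F]≤|S∖[A]|ψ+|G∖F|ψ = begin
    sumF (λ x → countF (λ y → adj x y ∧ S x ∧ not (F y)))
      ≤⟨ sumF-mono (λ x → countF-≤-+ (edge-split x)) ⟩
    sumF (λ x → countF (from-S∖[A] x) + countF (λ y → into-G∖F y x))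
      ≡⟨ sumF-+ (λ x → countF (from-S∖[A] x)) (λ x → countF (λ y → into-G∖F y x)) ⟩
    sumF (λ x → countF (from-S∖[A] x)) + sumF (λ x → countF (λ y → into-G∖F y x))
      ≡⟨ cong (sumF (λ x → countF (from-S∖[A] x)) +_) (countF-comm (λ x y → into-G∖F y x)) ⟩
    sumF (λ x → countF (from-S∖[A] x)) + sumF (λ y → countF (into-G∖F y))
      ≤⟨ +-mono-≤
           (sumF-countF-∧-≤ (λ x y → adj x y ∧ not (F y))
             (λ x x∈S∖[A] → degInY-Y∖F≤ψ (T-∧-proj₁ (S x) x∈S∖[A])))
           (sumF-countF-∧-≤ (λ y x → adj x y ∧ S x)
             (λ y y∈G∖F → degInX-S≤ψ (T-∧-proj₂ (N y) y∈G∖F))) ⟩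
    countF (λ x → S x ∧ not (cl x)) * ψ + countF (λ y → N y ∧ not (F y)) * ψ
      ∎
    where
    open ≤-Reasoning
    from-S∖[A] : Fin m → Fin n → Bool
    from-S∖[A] x y = (S x ∧ not (cl x)) ∧ (adj x y ∧ not (F y))
    into-G∖F : Fin n → Fin m → Bool
    into-G∖F y x = (N y ∧ not (F y)) ∧ (adj x y ∧ S x)
    edge-split : ∀ x y → T (adj x y ∧ S x ∧ not (F y)) → T (from-S∖[A] x y) ⊎ T (into-G∖F y x)
    edge-split x y x~y∈S×Y∖F with adj x y | S x | F y | cl x | N y | closure∧adj⇒nbhd {x} {y}
    ... | true | true | false | false | _ | _ = inj₁ tt
    ... | true | true | false | true | true | _ = inj₂ tt
    ... | true | true | false | true | false | [A]∧adj⇒G = ⊥-elim ([A]∧adj⇒G tt tt)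

module Approximation {p r d : ℕ} (1≤p : 1 ≤ p) {m n : ℕ} (G : BipGraph m n)
  (p*d≤r*degX : ∀ x → p * d ≤ r * degX G x) (p*d≤r*degY : ∀ y → p * d ≤ r * degY G y)
  {ψ : ℕ} (2rψ≤d : 2 * r * ψ ≤ d)
  {A S : Fin m → Bool} {F : Fin n → Bool} (approx : IsApprox G ψ A S F) where

  private
    N : Fin n → Bool
    N = nbhd G A
    cl : Fin m → Bool
    cl = closure G A

  κ : ℕ
  κ = edgesYX G N (not ∘ cl)

  |S∖[A]|*d≤2rκ : countF (λ x → S x ∧ not (cl x)) * d ≤ 2 * r * κ
  |S∖[A]|*d≤2rκ = begin
    countF (λ x → S x ∧ not (cl x)) * d
      ≤⟨ countF-*-≤-sumF (λ x → 2 * r * countF (boundary-edge G approx x)) (λ x x∈S∖[A] →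
           degree-deficit r _ 1≤p (p*d≤r*degX x)
             (degX≤boundary+ψ G approx (T-∧-proj₁ (S x) x∈S∖[A]) (T-∧-proj₂ (S x) x∈S∖[A]))
             2rψ≤d) ⟩
    sumF (λ x → 2 * r * countF (boundary-edge G approx x))
      ≡⟨ sumF-*ˡ (2 * r) (countF ∘ boundary-edge G approx) ⟨
    2 * r * κ
      ∎
    where open ≤-Reasoning

  |G∖F|*d≤2rκ : countF (λ y → N y ∧ not (F y)) * d ≤ 2 * r * κ
  |G∖F|*d≤2rκ = begin
    countF (λ y → N y ∧ not (F y)) * d
      ≤⟨ countF-*-≤-sumF (λ y → 2 * r * countF (λ x → boundary-edge G approx x y)) (λ y y∈G∖F →
           degree-deficit r _ 1≤p (p*d≤r*degY y)
             (degY≤boundary+ψ G approx (T-∧-proj₁ (N y) y∈G∖F) (T-∧-proj₂ (N y) y∈G∖F))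
             2rψ≤d) ⟩
    sumF (λ y → 2 * r * countF (λ x → boundary-edge G approx x y))
      ≡⟨ sumF-*ˡ (2 * r) (λ y → countF (λ x → boundary-edge G approx x y)) ⟨
    2 * r * sumF (λ y → countF (λ x → boundary-edge G approx x y))
      ≡⟨ cong (2 * r *_) (countF-comm (boundary-edge G approx)) ⟨
    2 * r * κ
      ∎
    where open ≤-Reasoning

  ∇[S,Y∖F]*d≤4rκψ : edgesXY G S (not ∘ F) * d ≤ 4 * r * κ * ψ
  ∇[S,Y∖F]*d≤4rκψ = begin
    edgesXY G S (not ∘ F) * d            ≤⟨ *-monoˡ-≤ d (∇[S,Y∖F]≤|S∖[A]|ψ+|G∖F|ψ G approx) ⟩
    (|S∖[A]| * ψ + |G∖F| * ψ) * d        ≡⟨ regroup |S∖[A]| |G∖F| ψ d ⟩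
    |S∖[A]| * d * ψ + |G∖F| * d * ψ      ≤⟨ +-mono-≤ (*-monoˡ-≤ ψ |S∖[A]|*d≤2rκ) (*-monoˡ-≤ ψ |G∖F|*d≤2rκ) ⟩
    2 * r * κ * ψ + 2 * r * κ * ψ        ≡⟨ double r κ ψ ⟩
    4 * r * κ * ψ                        ∎
    where
    open ≤-Reasoning
    |S∖[A]| |G∖F| : ℕ
    |S∖[A]| = countF (λ x → S x ∧ not (cl x))
    |G∖F| = countF (λ y → N y ∧ not (F y))
    regroup : ∀ a b ψ d → (a * ψ + b * ψ) * d ≡ a * d * ψ + b * d * ψ
    regroup = solve-∀
    double : ∀ r κ ψ → 2 * r * κ * ψ + 2 * r * κ * ψ ≡ 4 * r * κ * ψ
    double = solve-∀

  |S|d²≤|F|d²+4r²κψ : 1 ≤ d → (∀ x y → T (BipGraph.adj G x y) → degY G y ≤ degX G x) →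
                      countF S * (d * d) ≤ countF F * (d * d) + 4 * r * r * κ * ψ
  |S|d²≤|F|d²+4r²κψ 1≤d degY≤degX = *-cancelˡ-≤ p {{>-nonZero 1≤p}} (begin
    p * (countF S * (d * d))
      ≡⟨ regroupˡ p d (countF S) ⟩
    p * d * countF S * d
      ≤⟨ *-monoˡ-≤ d p*d*|S|≤p*d*|F|+r*∇ ⟩
    (p * d * countF F + r * e) * d
      ≡⟨ regroupʳ p d (countF F) r e ⟩
    p * (countF F * (d * d)) + r * (e * d)
      ≤⟨ +-monoʳ-≤ _ (*-monoʳ-≤ r ∇[S,Y∖F]*d≤4rκψ) ⟩
    p * (countF F * (d * d)) + r * (4 * r * κ * ψ)
      ≡⟨ cong (p * (countF F * (d * d)) +_) (r*4rκψ r κ ψ) ⟩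
    p * (countF F * (d * d)) + 4 * r * r * κ * ψ
      ≤⟨ +-monoʳ-≤ _ (m≤n*m _ p {{>-nonZero 1≤p}}) ⟩
    p * (countF F * (d * d)) + p * (4 * r * r * κ * ψ)
      ≡⟨ *-distribˡ-+ p _ _ ⟨
    p * (countF F * (d * d) + 4 * r * r * κ * ψ)
      ∎)
    where
    open ≤-Reasoning
    e : ℕ
    e = edgesXY G S (not ∘ F)
    p*d*|S|≤p*d*|F|+r*∇ : p * d * countF S ≤ p * d * countF F + r * e
    p*d*|S|≤p*d*|F|+r*∇ = *-countF-≤-*-countF+∇ G
      (λ x → positive-degree {r = r} 1≤p 1≤d (p*d≤r*degX x))
      (λ y → positive-degree {r = r} 1≤p 1≤d (p*d≤r*degY y))
      degY≤degX (p * d) r p*d≤r*degX S F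
    regroupˡ : ∀ p d s → p * (s * (d * d)) ≡ p * d * s * d
    regroupˡ = solve-∀
    regroupʳ : ∀ p d f r e → (p * d * f + r * e) * d ≡ p * (f * (d * d)) + r * (e * d)
    regroupʳ = solve-∀
    r*4rκψ : ∀ r κ ψ → r * (4 * r * κ * ψ) ≡ 4 * r * r * κ * ψ
    r*4rκψ = solve-∀

proposition4p8 : (p r Δ : ℕ) → 1 ≤ p → p ≤ r →
    ∃ λ (C : ℕ) → ∃ λ (q : ℕ) → ∃ λ (d₀ : ℕ) →
    ∀ (d : ℕ) → d₀ ≤ d →
    ∀ {m n : ℕ} (G : BipGraph m n) →
    (∀ x → p * d ≤ r * degX G x) → (∀ x → degX G x ≤ d) →
    (∀ y → p * d ≤ r * degY G y) → (∀ y → degY G y ≤ d) →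
    (∀ x y → T (BipGraph.adj G x y) → degY G y ≤ degX G x) →
    (∀ x x' → ¬ x ≡ x' → codegX G x x' ≤ Δ) →
    (∀ y y' → ¬ y ≡ y' → codegY G y y' ≤ Δ) →
    ∀ (ψ : ℕ) → q * ψ ≤ d →
    ∀ (A S : Fin m → Bool) (F : Fin n → Bool) →
    TwoLinked G A →
    IsApprox G ψ A S F →
    let κ = edgesYX G (nbhd G A) (λ x → not (closure G A x)) in
    (countF (λ x → S x ∧ not (closure G A x)) * d ≤ C * κ)
    × (countF (λ y → nbhd G A y ∧ not (F y)) * d ≤ C * κ)
    × (edgesXY G S (λ y → not (F y)) * d ≤ C * κ * ψ)
    × (countF S * (d * d) ≤ countF F * (d * d) + C * κ * ψ)
proposition4p8 p r Δ 1≤p p≤r = 4 * r * r , 2 * r , 1 ,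
  λ d 1≤d G p*d≤r*degX _ p*d≤r*degY _ degY≤degX _ _ ψ 2rψ≤d A S F _ approx →
    let open Approximation {p} {r} {d} 1≤p G p*d≤r*degX p*d≤r*degY 2rψ≤d approx in
      ≤-trans |S∖[A]|*d≤2rκ (*-monoˡ-≤ κ 2r≤4rr)
    , ≤-trans |G∖F|*d≤2rκ (*-monoˡ-≤ κ 2r≤4rr)
    , ≤-trans ∇[S,Y∖F]*d≤4rκψ (*-monoˡ-≤ ψ (*-monoˡ-≤ κ 4r≤4rr))
    , |S|d²≤|F|d²+4r²κψ 1≤d degY≤degX
  where
  4r≤4rr : 4 * r ≤ 4 * r * r
  4r≤4rr = m≤m*n (4 * r) r {{>-nonZero (≤-trans 1≤p p≤r)}}
  2r≤4rr : 2 * r ≤ 4 * r * r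
  2r≤4rr = ≤-trans (*-monoˡ-≤ r {2} {4} (s≤s (s≤s z≤n))) 4r≤4rr
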